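{- Let $n>1$, $\textsf{AP}=\{p\}$, and let $K_n$ be a tree structure as described in the context. Then $K_n\models\varphi_p$, where $\varphi_p$ is the HyperLTL sentence $\exists x.\exists y.\; p[x]\,\textsf{U}\,\big((p[x]\wedge\neg p[y])\wedge\textsf{X}\textsf{G}(p[x]\leftrightarrow p[y])\big)$.
   Context: HyperCTL$^*$/HyperLTL semantics on a Kripke structure $K$ (with total transition relation and valuation $V$): formulas are evaluated w.r.t. a path assignment $\Pi$ (variables to initial paths), a current variable $y$ and a position $i$; $\Pi,y,i\models p[x]$ iff $p\in V(\Pi(x)(i))$; Booleans, $\textsf{X}$, $\textsf{U}$ standard on the position; $\textsf{F}\varphi=\top\textsf{U}\varphi$, $\textsf{G}\varphi=\neg\textsf{F}\neg\varphi$; $\Pi,y,i\models\exists x.\varphi$ iff some initial path $\pi$ with $\pi[0,i]=\Pi(y)[0,i]$ gives $\Pi[x\leftarrow\pi],x,i\models\varphi$. For a sentence, $K\models\varphi$ iff $\Pi,y,0\models\varphi$ for some (equivalently any) $\Pi,y$. A tree structure has nodes forming a prefix-closed subset of $\mathbb{N}^*$ with root $\varepsilon$ initial and edges only from $\tau$ to children $\tau\cdot i$; it is regular if it is the unwinding of a finite Kripke structure. $K_n$ is any regular tree structure over $2^{\{p\}}$ such that for some $\ell_n>1$: the root has label $\{p\}$ and exactly $2n+1$ successors $\eta,\xi_1,\ldots,\xi_{2n}$, with a unique initial path through $\eta$ (denoted $\pi(\eta)$) and through each $\xi_k$ (denoted $\pi(\xi_k)$); there are $2n+1$ distinct words $w_0,\ldots,w_{2n}$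 over $2^{\{p\}}$ of length $\ell_n$ with $w_0=\{p\}^{\ell_n}$, $w_n(\ell_n-1)=\emptyset$, $w_{n-1}(\ell_n-1)=\{p\}$, the trace of $\pi(\eta)$ is $\{p\}w_0\emptyset^n\{p\}^n\{p\}^\omega$ and the trace of $\pi(\xi_k)$ is $\{p\}w_k\emptyset^{2n-k}\{p\}^k\{p\}^\omega$ for $k\in[1,2n]$. -}

module Defs where

open import Data.Nat using (ℕ; zero; suc; _+_; _*_; _∸_; _≤_; _<_)
open import Data.Nat.Properties using (_≟_)
open import Data.Bool using (Bool; true; false)
open import Data.Fin using (Fin)
open import Data.List using (List; []; _∷_; _∷ʳ_)
open import Data.Product using (Σ; ∃; _×_; _,_; proj₁)
open import Data.Unit using (⊤)
open import Relation.Nullary using (¬_; yes; no)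
open import Relation.Binary.PropositionalEquality using (_≡_)

record Kripke (AP : Set) : Set₁ where
  field
    S    : Set
    init : S → Set
    R    : S → S → Set
    V    : S → AP → Bool

module _ {AP : Set} (K : Kripke AP) where
  open Kripke K

  record Path : Set where
    field
      seq  : ℕ → S
      step : ∀ i → R (seq i) (seq (suc i))
  open Path public

  InitPath : Set
  InitPath = Σ Path λ π → init (seq π 0)

Var : Set
Var = ℕ

data Form (AP : Set) : Set where
  tt'   : Form AP
  atom  : AP → Var → Form AP
  ¬'_   : Form AP → Form AP
  _∧'_  : Form AP → Form AP → Form AP
  X'    : Form AP → Form AP
  _U'_  : Form AP → Form AP → Form AP
  ∃'    : Var → Form AP → Form AP

module _ {AP : Set} where
  _∨'_ : Form AP → Form AP → Form AP
  φ ∨' ψ = ¬' ((¬' φ) ∧' (¬' ψ))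

  _⇒'_ : Form AP → Form AP → Form AP
  φ ⇒' ψ = (¬' φ) ∨' ψ

  _⇔'_ : Form AP → Form AP → Form AP
  φ ⇔' ψ = (φ ⇒' ψ) ∧' (ψ ⇒' φ)

  F' : Form AP → Form AP
  F' φ = tt' U' φ

  G' : Form AP → Form AP
  G' φ = ¬' (F' (¬' φ))

module Sem {AP : Set} (K : Kripke AP) where
  open Kripke K

  Assignment : Set
  Assignment = Var → InitPath K

  update : Assignment → Var → InitPath K → Assignment
  update Π x π z with z ≟ x
  ... | yes _ = π
  ... | no  _ = Π z

  st : InitPath K → ℕ → S
  st π i = seq {K = K} (proj₁ π) i

  _,_,_⊨_ : Assignment → Var → ℕ → Form AP → Set
  Π , y , i ⊨ tt'      = ⊤
  Π , y , i ⊨ atom p x = V (st (Π x) i) p ≡ true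
  Π , y , i ⊨ (¬' φ)   = ¬ (Π , y , i ⊨ φ)
  Π , y , i ⊨ (φ ∧' ψ) = (Π , y , i ⊨ φ) × (Π , y , i ⊨ ψ)
  Π , y , i ⊨ X' φ     = Π , y , suc i ⊨ φ
  Π , y , i ⊨ (φ U' ψ) =
    Σ ℕ λ k → (i ≤ k) × (Π , y , k ⊨ ψ) × (∀ j → i ≤ j → j < k → Π , y , j ⊨ φ)
  Π , y , i ⊨ ∃' x φ   =
    Σ (InitPath K) λ π → (∀ j → j ≤ i → st π j ≡ st (Π y) j)
                        × (update Π x π , x , i ⊨ φ)

  Models : Form AP → Set
  Models φ = Σ Assignment λ Π → Σ Var λ y → Π , y , 0 ⊨ φ

-- Tree structures over 2^{p} (AP = ⊤, the single proposition p).
-- Nodes: a prefix-closed subset of ℕ*, root [] ; τ·i is  τ ∷ʳ i.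

record TreeStructure : Set₁ where
  field
    Node          : List ℕ → Set
    root          : Node []
    prefix-closed : ∀ τ i → Node (τ ∷ʳ i) → Node τ
    lab           : List ℕ → Bool
    total         : ∀ τ → Node τ → ∃ λ i → Node (τ ∷ʳ i)

treeKripke : TreeStructure → Kripke ⊤
treeKripke T = record
  { S    = List ℕ
  ; init = λ τ → τ ≡ []
  ; R    = λ τ τ' → Node τ' × ∃ λ i → τ' ≡ τ ∷ʳ i
  ; V    = λ τ _ → lab τ
  }
  where open TreeStructure T

record FiniteKripke : Set₁ where
  field
    m     : ℕ
    s₀    : Fin m
    R     : Fin m → Fin m → Set
    lab   : Fin m → Bool
    total : ∀ s → ∃ λ s' → R s s'

-- T is (isomorphic to) the unwinding of the finite Kripke structure K:
-- there is a labelling-preserving map h from nodes to states, root ↦ s₀,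
-- which for every node maps its children bijectively onto the
-- successors of its image.
record UnwindingOf (T : TreeStructure) (K : FiniteKripke) : Set where
  open TreeStructure T
  open FiniteKripke K renaming (lab to labK; R to RK)
  field
    h        : List ℕ → Fin m
    h-root   : h [] ≡ s₀
    h-lab    : ∀ τ → Node τ → lab τ ≡ labK (h τ)
    h-edge   : ∀ τ i → Node τ → Node (τ ∷ʳ i) → RK (h τ) (h (τ ∷ʳ i))
    h-inj    : ∀ τ i j → Node (τ ∷ʳ i) → Node (τ ∷ʳ j)
               → h (τ ∷ʳ i) ≡ h (τ ∷ʳ j) → i ≡ j
    h-surj   : ∀ τ → Node τ → ∀ s → RK (h τ) s
               → ∃ λ i → Node (τ ∷ʳ i) × h (τ ∷ʳ i) ≡ s

Regular : TreeStructure → Set₁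
Regular T = Σ FiniteKripke λ K → UnwindingOf T K

module _ (T : TreeStructure) where
  open TreeStructure T

  IPath : Set
  IPath = InitPath (treeKripke T)

  node : IPath → ℕ → List ℕ
  node π i = seq {K = treeKripke T} (proj₁ π) i

  trace : IPath → ℕ → Bool
  trace π i = lab (node π i)

  Through : ℕ → IPath → Set
  Through c π = node π 1 ≡ c ∷ []

  UniquePathWithTrace : ℕ → (ℕ → Bool) → Set
  UniquePathWithTrace c t =
      (∃ λ π → Through c π)
    × (∀ π π' → Through c π → Through c π' → ∀ i → node π i ≡ node π' i)
    × (∀ π → Through c π → ∀ i → trace π i ≡ t i)

_++ω_ : List Bool → (ℕ → Bool) → ℕ → Bool
([] ++ω s) i           = s i
((b ∷ u) ++ω s) zero   = b
((b ∷ u) ++ω s) (suc i) = (u ++ω s) i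

pω : ℕ → Bool
pω _ = true

-- The formula φ_p, with x = 0 and y = 1, p = tt.

φp : Form ⊤
φp = ∃' 0 (∃' 1
       (atom _ 0 U' ((atom _ 0 ∧' (¬' atom _ 1))
                      ∧' X' (G' (atom _ 0 ⇔' atom _ 1)))))

module Submission where

-- Take x to be the path π(η) and y the path π(ξₙ).  Both
-- traces start with the root label, then read a word of length ℓ:
-- w₀ = {p}^ℓ for x, and wₙ, whose last letter is ∅, for y.  Hence p[x]
-- holds at every position 0 … ℓ while p[y] fails at position ℓ.  From
-- position ℓ+1 on, x reads ∅ⁿ{p}ⁿ{p}^ω and y reads ∅^(2n-n){p}ⁿ{p}^ω,
-- i.e. the same word, so p[x] ↔ p[y] holds forever after ℓ.  The until
-- formula is therefore fulfilled at position ℓ.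

open import Defs
open import Data.Nat using (ℕ; _*_; _∸_; _≤_; _<_)
open import Data.Bool using (Bool; true; false)
open import Data.List using (List; []; _∷_; _++_; replicate; length; last)
open import Data.Maybe using (just)
open import Data.Product using (∃; _×_)
open import Data.Sum using (_⊎_)
open import Relation.Binary.PropositionalEquality using (_≡_; _≢_)

open import Data.Nat using (zero; suc; _+_; z≤n; s≤s)
open import Data.Nat.Properties
  using (≤-refl; ≤-trans; n≤1+n; <⇒≤; m≤n*m; +-identityʳ; m+n∸n≡m; m+[n∸m]≡n)
open import Data.List.Properties using (length-replicate)
open import Data.Product using (Σ; _,_; proj₁; proj₂)
open import Data.Unit using (⊤; tt)
open import Relation.Binary.PropositionalEquality using (refl; sym; trans; cong; subst; module ≡-Reasoning)

constant-prefix : ∀ (c : Bool) m (v : List Bool) s i → i ≤ m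
  → ((c ∷ (replicate m c ++ v)) ++ω s) i ≡ c
constant-prefix c m       v s zero    _         = refl
constant-prefix c (suc m) v s (suc i) (s≤s i≤m) = constant-prefix c m v s i i≤m

last-position : ∀ (c : Bool) (u v : List Bool) s b → last u ≡ just b
  → ((c ∷ (u ++ v)) ++ω s) (length u) ≡ b
last-position c (x ∷ [])     v s .x refl = refl
last-position c (x ∷ y ∷ xs) v s b  e    = last-position x (y ∷ xs) v s b e

tail-position : ∀ (c : Bool) (u v : List Bool) s j
  → ((c ∷ (u ++ v)) ++ω s) (suc (length u + j)) ≡ (v ++ω s) j
tail-position c []      v s j = refl
tail-position c (x ∷ u) v s j = tail-position x u v s j

module _ (K : Kripke ⊤) where
  open Sem K

  p-at : InitPath K → ℕ → Bool
  p-at π i = Kripke.V K (st π i) tt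

  ⇔-intro : ∀ {Π y i} {φ ψ : Form ⊤}
    → (Π , y , i ⊨ φ → Π , y , i ⊨ ψ) → (Π , y , i ⊨ ψ → Π , y , i ⊨ φ)
    → Π , y , i ⊨ (φ ⇔' ψ)
  ⇔-intro φ→ψ ψ→φ = (λ { (¬¬φ , ¬ψ) → ¬¬φ (λ φ-holds → ¬ψ (φ→ψ φ-holds)) })
                  , (λ { (¬¬ψ , ¬φ) → ¬¬ψ (λ ψ-holds → ¬φ (ψ→φ ψ-holds)) })

  G-intro : ∀ {Π y i} {φ : Form ⊤}
    → (∀ k → i ≤ k → Π , y , k ⊨ φ) → Π , y , i ⊨ G' φ
  G-intro always (k , i≤k , ¬φ , _) = ¬φ (always k i≤k)

  φp-witness : (πx πy : InitPath K) → st πx 0 ≡ st πy 0 → (ℓ : ℕ)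
    → (∀ i → i ≤ ℓ → p-at πx i ≡ true)
    → p-at πy ℓ ≡ false
    → (∀ j → p-at πx (suc (ℓ + j)) ≡ p-at πy (suc (ℓ + j)))
    → Models φp
  φp-witness πx πy same-start ℓ x-holds y-fails agree =
    (λ _ → πx) , 0 , πx , start {πx} {πx} refl , πy , start {πy} {πx} (sym same-start) , until
    where
    -- quantified paths must agree with the current one up to position 0
    start : ∀ {π π' : InitPath K} → st π 0 ≡ st π' 0 → ∀ j → j ≤ 0 → st π j ≡ st π' j
    start e .0 z≤n = e

    Πxy : Assignment
    Πxy = update (update (λ _ → πx) 0 πx) 1 πy

    y-not-p : Πxy , 1 , ℓ ⊨ (¬' atom tt 1)
    y-not-p p-holds with trans (sym p-holds) y-fails
    ... | ()

    agree-after : ∀ k → ℓ < k → p-at πx k ≡ p-at πy k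
    agree-after k ℓ<k =
      subst (λ m → p-at πx m ≡ p-at πy m) (m+[n∸m]≡n ℓ<k) (agree (k ∸ suc ℓ))

    xy-equivalent : ∀ k → ℓ < k → Πxy , 1 , k ⊨ (atom tt 0 ⇔' atom tt 1)
    xy-equivalent k ℓ<k = ⇔-intro {Πxy} {1} {k} {atom tt 0} {atom tt 1}
      (λ p-x → trans (sym (agree-after k ℓ<k)) p-x)
      (λ p-y → trans (agree-after k ℓ<k) p-y)

    until : Πxy , 1 , 0 ⊨ (atom tt 0 U' ((atom tt 0 ∧' (¬' atom tt 1))
                                        ∧' X' (G' (atom tt 0 ⇔' atom tt 1))))
    until = ℓ , z≤n
          , ( (x-holds ℓ ≤-refl , y-not-p)
            , G-intro {Πxy} {1} {suc ℓ} {atom tt 0 ⇔' atom tt 1} xy-equivalent)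
          , (λ j _ j<ℓ → x-holds j (<⇒≤ j<ℓ))

  word-witness : (πx πy : InitPath K) → st πx 0 ≡ st πy 0
    → (ℓ : ℕ) (u v : List Bool) (s : ℕ → Bool) → length u ≡ ℓ → last u ≡ just false
    → (∀ i → p-at πx i ≡ ((true ∷ (replicate ℓ true ++ v)) ++ω s) i)
    → (∀ i → p-at πy i ≡ ((true ∷ (u ++ v)) ++ω s) i)
    → Models φp
  word-witness πx πy same-start .(length u) u v s refl u-ends-in-∅ x-trace y-trace =
    φp-witness πx πy same-start ℓ x-holds y-fails agree
    where
    open ≡-Reasoning

    ℓ : ℕ
    ℓ = length u

    x-holds : ∀ i → i ≤ ℓ → p-at πx i ≡ true
    x-holds i i≤ℓ = trans (x-trace i) (constant-prefix true ℓ v s i i≤ℓ)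

    y-fails : p-at πy ℓ ≡ false
    y-fails = trans (y-trace ℓ) (last-position true u v s false u-ends-in-∅)

    -- after position ℓ both traces read v·s
    agree : ∀ j → p-at πx (suc (ℓ + j)) ≡ p-at πy (suc (ℓ + j))
    agree j = begin
      p-at πx (suc (ℓ + j))                                   ≡⟨ x-trace _ ⟩
      ((true ∷ (replicate ℓ true ++ v)) ++ω s) (suc (ℓ + j))
        ≡⟨ cong (λ m → ((true ∷ (replicate ℓ true ++ v)) ++ω s) (suc (m + j)))
                (sym (length-replicate ℓ)) ⟩
      ((true ∷ (replicate ℓ true ++ v)) ++ω s) (suc (length (replicate ℓ true) + j))
        ≡⟨ tail-position true (replicate ℓ true) v s j ⟩
      (v ++ω s) j                                             ≡⟨ tail-position true u v s j ⟨
      ((true ∷ (u ++ v)) ++ω s) (suc (ℓ + j))                 ≡⟨ y-trace _ ⟨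
      p-at πy (suc (ℓ + j))                                   ∎

path-with-trace : ∀ {T c t} → UniquePathWithTrace T c t
  → Σ (IPath T) λ π → ∀ i → trace T π i ≡ t i
path-with-trace ((π , through) , _ , has-trace) = π , has-trace π through

-- the block ∅^(2n-n) of π(ξₙ) is ∅ⁿ, as for π(η)
2n∸n≡n : ∀ n → 2 * n ∸ n ≡ n
2n∸n≡n n = trans (cong (_∸ n) (cong (n +_) (+-identityʳ n))) (m+n∸n≡m n n)

proposition1 : (n : ℕ) → 1 < n
    → (T : TreeStructure) → Regular T
    → (ℓ : ℕ) → 1 < ℓ
    → (η : ℕ) (ξ : ℕ → ℕ) (w : ℕ → List Bool)
    → TreeStructure.lab T [] ≡ true
    → (∀ i → TreeStructure.Node T (i ∷ [])
    → (i ≡ η ⊎ ∃ λ k → 1 ≤ k × k ≤ 2 * n × i ≡ ξ k))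
    → TreeStructure.Node T (η ∷ [])
    → (∀ k → 1 ≤ k → k ≤ 2 * n → TreeStructure.Node T (ξ k ∷ []))
    → (∀ k → 1 ≤ k → k ≤ 2 * n → η ≢ ξ k)
    → (∀ j k → 1 ≤ j → j ≤ 2 * n → 1 ≤ k → k ≤ 2 * n → j ≢ k → ξ j ≢ ξ k)
    → (∀ k → k ≤ 2 * n → length (w k) ≡ ℓ)
    → (∀ j k → j ≤ 2 * n → k ≤ 2 * n → j ≢ k → w j ≢ w k)
    → w 0 ≡ replicate ℓ true
    → last (w n) ≡ just false
    → last (w (n ∸ 1)) ≡ just true
    → UniquePathWithTrace T η
    ((true ∷ (w 0 ++ (replicate n false ++ replicate n true))) ++ω pω)
    → (∀ k → 1 ≤ k → k ≤ 2 * n →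
    UniquePathWithTrace T (ξ k)
    ((true ∷ (w k ++ (replicate (2 * n ∸ k) false ++ replicate k true))) ++ω pω))
    → Sem.Models (treeKripke T) φp
proposition1 n 1<n T _ ℓ _ η ξ w _ _ _ _ _ _ length-w _ w₀-all-p last-wₙ _ path-η path-ξ =
  word-witness (treeKripke T) πη πξ (trans (proj₂ πη) (sym (proj₂ πξ)))
               ℓ (w n) Rₙ pω (length-w n n≤2n) last-wₙ η-trace ξₙ-trace
  where
  n≤2n : n ≤ 2 * n
  n≤2n = m≤n*m n 2

  Rₙ : List Bool
  Rₙ = replicate n false ++ replicate n true

  η-path : Σ (IPath T) λ π → ∀ i → trace T π i ≡ ((true ∷ (w 0 ++ Rₙ)) ++ω pω) i
  η-path = path-with-trace {T} {η} path-η

  ξₙ-path : Σ (IPath T) λ π → ∀ i → trace T π i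
          ≡ ((true ∷ (w n ++ (replicate (2 * n ∸ n) false ++ replicate n true))) ++ω pω) i
  ξₙ-path = path-with-trace {T} {ξ n} (path-ξ n (≤-trans (n≤1+n 1) 1<n) n≤2n)

  πη πξ : IPath T
  πη = proj₁ η-path
  πξ = proj₁ ξₙ-path

  η-trace : ∀ i → trace T πη i ≡ ((true ∷ (replicate ℓ true ++ Rₙ)) ++ω pω) i
  η-trace i = trans (proj₂ η-path i) (cong (λ u → ((true ∷ (u ++ Rₙ)) ++ω pω) i) w₀-all-p)

  ξₙ-trace : ∀ i → trace T πξ i ≡ ((true ∷ (w n ++ Rₙ)) ++ω pω) i
  ξₙ-trace i = trans (proj₂ ξₙ-path i)
    (cong (λ m → ((true ∷ (w n ++ (replicate m false ++ replicate n true))) ++ω pω) i) (2n∸n≡n n))
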